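{- For all integers $1\le k\le n$, $$\sum_{i=k}^n i\binom{i-1}{k-1}\binom{2n}{n-i}=\frac{2^{n-k}}{(n-1)!}\sum_{i=1}^k(-1)^{k+i}\binom{k}{i}\, i(i+2)(i+4)\cdots(i+2n-2).$$
   Context: $i(i+2)\cdots(i+2n-2)=\prod_{j=0}^{n-1}(i+2j)$. -}

module Defs where

open import Data.Nat using (ℕ; zero; suc; _+_; _*_; _∸_)
open import Data.Integer using (ℤ; +_)
import Data.Integer as ℤ

sumFromTo : ℕ → ℕ → (ℕ → ℤ) → ℤ
sumFromTo a b f = go (suc b ∸ a)
  where
  go : ℕ → ℤ
  go zero = + 0
  go (suc m) = go m ℤ.+ f (a + m)

prodStep2 : ℕ → ℕ → ℕ
prodStep2 i zero = 1
prodStep2 i (suc n) = prodStep2 i n * (i + 2 * n)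

signPow : ℕ → ℤ
signPow zero = + 1
signPow (suc m) = ℤ.- signPow m

module Submission where

-- Write A(n,k) and B(n,k) for the sums on the two sides (B without the factor 2^(n-k)/(n-1)!).
-- Since i C(i-1,k-1) = k C(i,k), A(n,k) = k [x^(n-k)] (1 + x)^(2n) (1 - x)^-(k+1), and eliminating
-- between the Pascal and derivative relations of these coefficients gives
--   n A(n+1,k) = 2(2n+k) A(n,k) + k A(n,k-1).
-- Termwise, Pascal's rule and absorption give B(n+1,k) = (2n+k) B(n,k) + k B(n,k-1).
-- Hence 2^k (n-1)! A(n,k) and 2^n B(n,k) obey the same recurrence in n, and they agree at n = 1.

open import Algebra.Bundles using (CommutativeSemiring)
open import Data.Nat using (ℕ; zero; suc; _<_)
open import Data.Nat.Properties using (≤-refl; m<n⇒m<1+n)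

module RangeSum {c ℓ} (R : CommutativeSemiring c ℓ) where

  open CommutativeSemiring R
  open import Algebra.Properties.CommutativeSemigroup +-commutativeSemigroup using (interchange)

  ∑< : ℕ → (ℕ → Carrier) → Carrier
  ∑< zero    f = 0#
  ∑< (suc s) f = ∑< s f + f s

  ∑<-cong : ∀ s {f g : ℕ → Carrier} → (∀ t → t < s → f t ≈ g t) → ∑< s f ≈ ∑< s g
  ∑<-cong zero    f≈g = refl
  ∑<-cong (suc s) f≈g = +-cong (∑<-cong s (λ t t<s → f≈g t (m<n⇒m<1+n t<s))) (f≈g s ≤-refl)

  ∑<-+ : ∀ s (f g : ℕ → Carrier) → ∑< s (λ t → f t + g t) ≈ ∑< s f + ∑< s g
  ∑<-+ zero    f g = sym (+-identityˡ 0#)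
  ∑<-+ (suc s) f g = trans (+-cong (∑<-+ s f g) refl) (interchange _ _ (f s) (g s))

  *-distribˡ-∑< : ∀ s x (f : ℕ → Carrier) → x * ∑< s f ≈ ∑< s (λ t → x * f t)
  *-distribˡ-∑< zero    x f = zeroʳ x
  *-distribˡ-∑< (suc s) x f = trans (distribˡ x (∑< s f) (f s)) (+-cong (*-distribˡ-∑< s x f) refl)

  ∑<-suc : ∀ s (f : ℕ → Carrier) → ∑< (suc s) f ≈ f 0 + ∑< s (λ t → f (suc t))
  ∑<-suc zero    f = +-comm 0# (f 0)
  ∑<-suc (suc s) f = trans (+-cong (∑<-suc s f) refl) (+-assoc (f 0) _ _)

open import Data.Nat using (_+_; _*_; _∸_; _^_; _!; _≤_; z≤n; s≤s; s<s⁻¹; NonZero)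
open import Data.Nat.Properties
open import Data.Nat.Combinatorics using (_C_; nCk+nC[k+1]≡[n+1]C[k+1]; k>n⇒nCk≡0; nCk≡nC[n∸k]; nCn≡1; nC1≡n)
import Data.Nat.Tactic.RingSolver as ℕ-Solver
import Data.Integer.Tactic.RingSolver as ℤ-Solver
open import Algebra.Properties.CommutativeSemigroup *-commutativeSemigroup using (x∙yz≈y∙xz)
open import Data.Integer using (ℤ; +_)
import Data.Integer as ℤ
import Data.Integer.Properties as ℤP
open import Data.Rational using (_/_)
import Data.Rational as ℚ
import Data.Rational.Properties as ℚP
import Data.Rational.Unnormalised as ℚᵘ
import Data.Rational.Unnormalised.Properties as ℚᵘP
open import Relation.Binary.Definitions using (tri<; tri≈; tri>)
open import Relation.Binary.PropositionalEquality

open import Defs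

module ℕ∑ = RangeSum +-*-commutativeSemiring
module ℤ∑ = RangeSum ℤP.+-*-commutativeSemiring

∑<-pos : ∀ s (f : ℕ → ℕ) → ℤ∑.∑< s (λ t → + f t) ≡ + ℕ∑.∑< s f
∑<-pos zero    f = refl
∑<-pos (suc s) f = trans (cong (ℤ._+ + f s) (∑<-pos s f)) (sym (ℤP.pos-+ (ℕ∑.∑< s f) (f s)))

suc-+-∸ : ∀ a m → suc (a + m) ∸ a ≡ suc m
suc-+-∸ a m = trans (+-∸-assoc 1 (m≤m+n a m)) (cong suc (m+n∸m≡n a m))

sumFromTo-∑< : ∀ a b f → sumFromTo a b f ≡ ℤ∑.∑< (suc b ∸ a) (λ t → f (a + t))
sumFromTo-∑< a b f = sumFromTo-count b (suc b ∸ a) refl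
  where
  -- the recursion of `sumFromTo` is local to its definition and runs on `suc b ∸ a`; it is reached by rewriting that count
  sumFromTo-count : ∀ b w → suc b ∸ a ≡ w → sumFromTo a b f ≡ ℤ∑.∑< w (λ t → f (a + t))
  sumFromTo-count b zero          count rewrite count = refl
  sumFromTo-count b (suc zero)    count rewrite count = refl
  sumFromTo-count b (suc (suc w)) count =
    trans (drop-last count (suc-+-∸ a w)) (cong (ℤ._+ f (a + suc w)) (sumFromTo-count (a + w) (suc w) (suc-+-∸ a w)))
    where
    drop-last : ∀ {b b′} → suc b ∸ a ≡ suc (suc w) → suc b′ ∸ a ≡ suc w →
                sumFromTo a b f ≡ sumFromTo a b′ f ℤ.+ f (a + suc w)
    drop-last c c′ rewrite c | c′ = refl

C-pascal : ∀ n k → suc n C suc k ≡ n C k + n C suc k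
C-pascal n k = sym (nCk+nC[k+1]≡[n+1]C[k+1] n k)

C-symmetric : ∀ m k → (m + k) C m ≡ (m + k) C k
C-symmetric m k = trans (nCk≡nC[n∸k] (m≤m+n m k)) (cong ((m + k) C_) (m+n∸m≡n m k))

C-absorption : ∀ n k → suc k * (suc n C suc k) ≡ suc n * (n C k)
C-absorption n       zero    = trans (+-identityʳ (suc n C 1)) (trans (nC1≡n (suc n)) (sym (*-identityʳ (suc n))))
C-absorption zero    (suc k) = trans (cong (suc (suc k) *_) (k>n⇒nCk≡0 (s≤s (s≤s (z≤n {k}))))) (*-zeroʳ (suc (suc k)))
C-absorption (suc n) (suc k) = begin
    suc (suc k) * (suc (suc n) C suc (suc k))
  ≡⟨ cong (suc (suc k) *_) (C-pascal (suc n) (suc k)) ⟩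
    suc (suc k) * (X + Y)
  ≡⟨ expand k X Y ⟩
    X + (suc k * X + suc (suc k) * Y)
  ≡⟨ cong (λ u → X + u) (cong₂ _+_ (C-absorption n k) (C-absorption n (suc k))) ⟩
    X + (suc n * (n C k) + suc n * (n C suc k))
  ≡⟨ cong (λ u → X + u) (trans (sym (*-distribˡ-+ (suc n) (n C k) (n C suc k))) (cong (suc n *_) (sym (C-pascal n k)))) ⟩
    suc (suc n) * X ∎
  where
  open ≡-Reasoning
  X = suc n C suc k
  Y = suc n C suc (suc k)
  expand : ∀ k X Y → suc (suc k) * (X + Y) ≡ X + (suc k * X + suc (suc k) * Y)
  expand = ℕ-Solver.solve-∀

multichoose : ℕ → ℕ → ℕ
multichoose β t = (β + t) C β

multichoose-zero : ∀ β → multichoose β 0 ≡ 1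
multichoose-zero β = trans (cong (_C β) (+-identityʳ β)) (nCn≡1 β)

multichoose-one : ∀ β → multichoose β 1 ≡ suc β
multichoose-one β = trans (C-symmetric β 1) (trans (nC1≡n (β + 1)) (+-comm β 1))

multichoose-pascal : ∀ β t → multichoose (suc β) (suc t) ≡ multichoose β (suc t) + multichoose (suc β) t
multichoose-pascal β t rewrite +-suc β t = C-pascal (suc (β + t)) β

multichoose-absorption : ∀ β t → suc t * multichoose β (suc t) ≡ suc β * multichoose (suc β) t
multichoose-absorption β t = begin
  suc t * ((β + suc t) C β)        ≡⟨ cong (suc t *_) (C-symmetric β (suc t)) ⟩
  suc t * ((β + suc t) C suc t)    ≡⟨ cong (λ n → suc t * (n C suc t)) (+-suc β t) ⟩
  suc t * (suc (β + t) C suc t)    ≡⟨ C-absorption (β + t) t ⟩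
  suc (β + t) * ((β + t) C t)      ≡⟨ cong (suc (β + t) *_) (C-symmetric β t) ⟨
  suc (β + t) * ((β + t) C β)      ≡⟨ C-absorption (β + t) β ⟨
  suc β * (suc (β + t) C suc β)    ∎
  where open ≡-Reasoning

-- coeff a β m is the coefficient of x^m in F a β = (1 + x)^a (1 - x)^-(β+1); coeff-pascalᵃ, coeff-pascalᵝ and
-- coeff-derivative are the coefficient forms of (1 + x) F a β = F (a+1) β, F a β = (1 - x) F a (β+1) and
-- F′ (a+1) β = (a+1) F a β + (β+1) F (a+1) (β+1).
coeff : ℕ → ℕ → ℕ → ℕ
coeff a β m = ℕ∑.∑< (suc m) (λ t → (a C (m ∸ t)) * multichoose β t)

coeff-zero : ∀ a β → coeff a β 0 ≡ 1
coeff-zero a β = trans (*-identityˡ (multichoose β 0)) (multichoose-zero β)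

coeff-one : ∀ a β → coeff a β 1 ≡ a + suc β
coeff-one a β = cong₂ _+_
  (trans (cong₂ _*_ (nC1≡n a) (multichoose-zero β)) (*-identityʳ a))
  (trans (*-identityˡ (multichoose β 1)) (multichoose-one β))

private
  suc-∸ : ∀ {m t} → t < suc m → suc m ∸ t ≡ suc (m ∸ t)
  suc-∸ (s≤s t≤m) = +-∸-assoc 1 t≤m

  C-∸-self : ∀ a m x → (a C (m ∸ m)) * x ≡ x
  C-∸-self a m x = trans (cong (λ j → (a C j) * x) (n∸n≡0 m)) (*-identityˡ x)

coeff-pascalᵃ : ∀ a β m → coeff (suc a) β (suc m) ≡ coeff a β (suc m) + coeff a β m
coeff-pascalᵃ a β m = begin
    ℕ∑.∑< (suc m) F + F (suc m)
  ≡⟨ cong₂ _+_ (ℕ∑.∑<-cong (suc m) F≡G+H) (C-∸-self (suc a) m (multichoose β (suc m))) ⟩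
    ℕ∑.∑< (suc m) (λ t → G t + H t) + multichoose β (suc m)
  ≡⟨ cong (_+ multichoose β (suc m)) (ℕ∑.∑<-+ (suc m) G H) ⟩
    ℕ∑.∑< (suc m) G + ℕ∑.∑< (suc m) H + multichoose β (suc m)
  ≡⟨ +-assoc-comm (ℕ∑.∑< (suc m) G) (ℕ∑.∑< (suc m) H) (multichoose β (suc m)) ⟩
    ℕ∑.∑< (suc m) G + multichoose β (suc m) + ℕ∑.∑< (suc m) H
  ≡⟨ cong (λ x → ℕ∑.∑< (suc m) G + x + ℕ∑.∑< (suc m) H) (C-∸-self a m (multichoose β (suc m))) ⟨
    coeff a β (suc m) + coeff a β m ∎
  where
  open ≡-Reasoning
  F G H : ℕ → ℕ
  F t = (suc a C (suc m ∸ t)) * multichoose β t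
  G t = (a C (suc m ∸ t)) * multichoose β t
  H t = (a C (m ∸ t)) * multichoose β t
  F≡G+H : ∀ t → t < suc m → F t ≡ G t + H t
  F≡G+H t t<1+m rewrite suc-∸ t<1+m =
    trans (cong (_* multichoose β t) (C-pascal a (m ∸ t)))
          (trans (*-distribʳ-+ (multichoose β t) (a C (m ∸ t)) (a C suc (m ∸ t))) (+-comm (H t) _))
  +-assoc-comm : ∀ x y z → x + y + z ≡ x + z + y
  +-assoc-comm = ℕ-Solver.solve-∀

coeff-pascalᵝ : ∀ a β m → coeff a (suc β) (suc m) ≡ coeff a β (suc m) + coeff a (suc β) m
coeff-pascalᵝ a β m = begin
    coeff a (suc β) (suc m)
  ≡⟨ ℕ∑.∑<-suc (suc m) (λ t → (a C (suc m ∸ t)) * multichoose (suc β) t) ⟩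
    (a C suc m) * multichoose (suc β) 0 + ℕ∑.∑< (suc m) (λ t → (a C (m ∸ t)) * multichoose (suc β) (suc t))
  ≡⟨ cong₂ _+_ (cong ((a C suc m) *_) (trans (multichoose-zero (suc β)) (sym (multichoose-zero β))))
               (ℕ∑.∑<-cong (suc m) λ t _ → trans (cong ((a C (m ∸ t)) *_) (multichoose-pascal β t))
                                                 (*-distribˡ-+ (a C (m ∸ t)) _ _)) ⟩
    (a C suc m) * multichoose β 0 + ℕ∑.∑< (suc m) (λ t → S t + T t)
  ≡⟨ cong (λ x → (a C suc m) * multichoose β 0 + x) (ℕ∑.∑<-+ (suc m) S T) ⟩
    (a C suc m) * multichoose β 0 + (ℕ∑.∑< (suc m) S + coeff a (suc β) m)
  ≡⟨ +-assoc ((a C suc m) * multichoose β 0) (ℕ∑.∑< (suc m) S) (coeff a (suc β) m) ⟨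
    (a C suc m) * multichoose β 0 + ℕ∑.∑< (suc m) S + coeff a (suc β) m
  ≡⟨ cong (_+ coeff a (suc β) m) (ℕ∑.∑<-suc (suc m) (λ t → (a C (suc m ∸ t)) * multichoose β t)) ⟨
    coeff a β (suc m) + coeff a (suc β) m ∎
  where
  open ≡-Reasoning
  S T : ℕ → ℕ
  S t = (a C (m ∸ t)) * multichoose β (suc t)
  T t = (a C (m ∸ t)) * multichoose (suc β) t

coeff-derivative : ∀ a β m →
  suc m * coeff (suc a) β (suc m) ≡ suc a * coeff a β m + suc β * coeff (suc a) (suc β) m
coeff-derivative a β m = begin
    suc m * coeff (suc a) β (suc m)
  ≡⟨ ℕ∑.*-distribˡ-∑< (suc (suc m)) (suc m) F ⟩
    ℕ∑.∑< (suc (suc m)) (λ t → suc m * F t)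
  ≡⟨ ℕ∑.∑<-cong (suc (suc m)) split ⟩
    ℕ∑.∑< (suc (suc m)) (λ t → (suc m ∸ t) * F t + t * F t)
  ≡⟨ ℕ∑.∑<-+ (suc (suc m)) (λ t → (suc m ∸ t) * F t) (λ t → t * F t) ⟩
    ℕ∑.∑< (suc (suc m)) (λ t → (suc m ∸ t) * F t) + ℕ∑.∑< (suc (suc m)) (λ t → t * F t)
  ≡⟨ cong₂ _+_ binomial-part multichoose-part ⟩
    suc a * coeff a β m + suc β * coeff (suc a) (suc β) m ∎
  where
  open ≡-Reasoning
  F : ℕ → ℕ
  F t = (suc a C (suc m ∸ t)) * multichoose β t

  split : ∀ t → t < suc (suc m) → suc m * F t ≡ (suc m ∸ t) * F t + t * F t
  split t (s≤s t≤1+m) = trans (cong (_* F t) (sym (m∸n+n≡m t≤1+m))) (*-distribʳ-+ (F t) (suc m ∸ t) t)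

  binomial-part : ℕ∑.∑< (suc (suc m)) (λ t → (suc m ∸ t) * F t) ≡ suc a * coeff a β m
  binomial-part = begin
      ℕ∑.∑< (suc m) (λ t → (suc m ∸ t) * F t) + (suc m ∸ suc m) * F (suc m)
    ≡⟨ cong₂ _+_ (ℕ∑.∑<-cong (suc m) absorb) (cong (_* F (suc m)) (n∸n≡0 m)) ⟩
      ℕ∑.∑< (suc m) (λ t → suc a * ((a C (m ∸ t)) * multichoose β t)) + 0
    ≡⟨ +-identityʳ _ ⟩
      ℕ∑.∑< (suc m) (λ t → suc a * ((a C (m ∸ t)) * multichoose β t))
    ≡⟨ ℕ∑.*-distribˡ-∑< (suc m) (suc a) (λ t → (a C (m ∸ t)) * multichoose β t) ⟨
      suc a * coeff a β m ∎
    where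
    absorb : ∀ t → t < suc m → (suc m ∸ t) * F t ≡ suc a * ((a C (m ∸ t)) * multichoose β t)
    absorb t t<1+m rewrite suc-∸ t<1+m =
      trans (sym (*-assoc (suc (m ∸ t)) (suc a C suc (m ∸ t)) (multichoose β t)))
            (trans (cong (_* multichoose β t) (C-absorption a (m ∸ t))) (*-assoc (suc a) (a C (m ∸ t)) (multichoose β t)))

  multichoose-part : ℕ∑.∑< (suc (suc m)) (λ t → t * F t) ≡ suc β * coeff (suc a) (suc β) m
  multichoose-part = begin
      ℕ∑.∑< (suc (suc m)) (λ t → t * F t)
    ≡⟨ ℕ∑.∑<-suc (suc m) (λ t → t * F t) ⟩
      ℕ∑.∑< (suc m) (λ t → suc t * ((suc a C (m ∸ t)) * multichoose β (suc t)))
    ≡⟨ ℕ∑.∑<-cong (suc m) (λ t _ → absorb t) ⟩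
      ℕ∑.∑< (suc m) (λ t → suc β * ((suc a C (m ∸ t)) * multichoose (suc β) t))
    ≡⟨ ℕ∑.*-distribˡ-∑< (suc m) (suc β) (λ t → (suc a C (m ∸ t)) * multichoose (suc β) t) ⟨
      suc β * coeff (suc a) (suc β) m ∎
    where
    absorb : ∀ t → suc t * ((suc a C (m ∸ t)) * multichoose β (suc t)) ≡ suc β * ((suc a C (m ∸ t)) * multichoose (suc β) t)
    absorb t = begin
        suc t * (B * multichoose β (suc t))   ≡⟨ x∙yz≈y∙xz (suc t) B (multichoose β (suc t)) ⟩
        B * (suc t * multichoose β (suc t))   ≡⟨ cong (B *_) (multichoose-absorption β t) ⟩
        B * (suc β * multichoose (suc β) t)   ≡⟨ x∙yz≈y∙xz B (suc β) (multichoose (suc β) t) ⟩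
        suc β * (B * multichoose (suc β) t)   ∎
      where B = suc a C (m ∸ t)

private
  -- The Pascal relations are substituted by matching on `refl`; what remains is the first
  -- derivative relation plus twice the second, which the solver checks.
  coeff-elimination : ∀ m κ X p₁ q₁ p q r V₂ V₁ w Z →
    X ≡ p₁ + q₁ → p₁ ≡ p + q → q₁ ≡ q + r → V₂ ≡ V₁ + w → V₁ ≡ q₁ + w → p ≡ Z + q →
    suc (suc m) * X ≡ suc (suc (2 * (suc κ + suc m))) * q₁ + suc (suc κ) * V₂ →
    suc m * q₁ ≡ suc (2 * (suc κ + suc m)) * r + suc (suc κ) * w →
    (suc κ + suc m) * X ≡ 2 * (2 * (suc κ + suc m) + suc κ) * q + κ * Z
  coeff-elimination m κ ._ ._ ._ ._ q r ._ ._ w Z refl refl refl refl refl refl derivative₁ derivative₂ =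
    +-cancelʳ-≡ (rhs₁ + 2 * lhs₂) _ _
      (trans (identity m κ q r w Z) (cong₂ (λ x y → target + (x + 2 * y)) derivative₁ (sym derivative₂)))
    where
    target = 2 * (2 * (suc κ + suc m) + suc κ) * q + κ * Z
    rhs₁ = suc (suc (2 * (suc κ + suc m))) * (q + r) + suc (suc κ) * (((q + r) + w) + w)
    lhs₂ = suc m * (q + r)
    identity : ∀ m κ q r w Z →
      (suc κ + suc m) * (((Z + q) + q) + (q + r))
        + (suc (suc (2 * (suc κ + suc m))) * (q + r) + suc (suc κ) * (((q + r) + w) + w) + 2 * (suc m * (q + r)))
      ≡ (2 * (2 * (suc κ + suc m) + suc κ) * q + κ * Z)
        + (suc (suc m) * (((Z + q) + q) + (q + r)) + 2 * (suc (2 * (suc κ + suc m)) * r + suc (suc κ) * w))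
    identity = ℕ-Solver.solve-∀

coeff-recurrence : ∀ κ m → let n = suc κ + m in
  n * coeff (2 * suc n) (suc κ) (suc m) ≡ 2 * (2 * n + suc κ) * coeff (2 * n) (suc κ) m + κ * coeff (2 * n) κ (suc m)
coeff-recurrence κ zero
  rewrite coeff-one (2 * suc (suc κ + 0)) (suc κ) | coeff-zero (2 * (suc κ + 0)) (suc κ) | coeff-one (2 * (suc κ + 0)) κ
  = identity κ
  where
  identity : ∀ κ → (suc κ + 0) * (2 * suc (suc κ + 0) + suc (suc κ))
                   ≡ 2 * (2 * (suc κ + 0) + suc κ) * 1 + κ * (2 * (suc κ + 0) + suc κ)
  identity = ℕ-Solver.solve-∀
coeff-recurrence κ (suc m) rewrite *-suc 2 (suc κ + suc m) =
  coeff-elimination m κ _ _ _ _ _ _ _ _ _ _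
    (coeff-pascalᵃ (suc a) k (suc m)) (coeff-pascalᵃ a k (suc m)) (coeff-pascalᵃ a k m)
    (coeff-pascalᵃ (suc a) (suc k) m) (coeff-pascalᵝ (suc a) k m) (coeff-pascalᵝ a κ (suc m))
    (coeff-derivative (suc a) k (suc m)) (coeff-derivative a k m)
  where
  k = suc κ
  a = 2 * (suc κ + suc m)

lhsSum : ℕ → ℕ → ℤ
lhsSum n k = sumFromTo k n (λ i → + (i * ((i ∸ 1) C (k ∸ 1)) * ((2 * n) C (n ∸ i))))

lhsSum≡coeff : ∀ κ m n → n ≡ suc κ + m → lhsSum n (suc κ) ≡ + (suc κ * coeff (2 * n) (suc κ) m)
lhsSum≡coeff κ m ._ refl = begin
    lhsSum n k
  ≡⟨ sumFromTo-∑< k n _ ⟩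
    ℤ∑.∑< (suc n ∸ k) (λ t → + ((k + t) * ((κ + t) C κ) * ((2 * n) C (n ∸ (k + t)))))
  ≡⟨ cong (λ w → ℤ∑.∑< w (λ t → + ((k + t) * ((κ + t) C κ) * ((2 * n) C (n ∸ (k + t)))))) (suc-+-∸ k m) ⟩
    ℤ∑.∑< (suc m) (λ t → + ((k + t) * ((κ + t) C κ) * ((2 * n) C (n ∸ (k + t)))))
  ≡⟨ ℤ∑.∑<-cong (suc m) (λ t _ → cong +_ (term t)) ⟩
    ℤ∑.∑< (suc m) (λ t → + (k * (((2 * n) C (m ∸ t)) * multichoose k t)))
  ≡⟨ ∑<-pos (suc m) (λ t → k * (((2 * n) C (m ∸ t)) * multichoose k t)) ⟩
    + ℕ∑.∑< (suc m) (λ t → k * (((2 * n) C (m ∸ t)) * multichoose k t))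
  ≡⟨ cong +_ (ℕ∑.*-distribˡ-∑< (suc m) k (λ t → ((2 * n) C (m ∸ t)) * multichoose k t)) ⟨
    + (k * coeff (2 * n) k m) ∎
  where
  open ≡-Reasoning
  k = suc κ
  n = k + m
  term : ∀ t → (k + t) * ((κ + t) C κ) * ((2 * n) C (n ∸ (k + t))) ≡ k * (((2 * n) C (m ∸ t)) * multichoose k t)
  term t = begin
      suc (κ + t) * ((κ + t) C κ) * ((2 * n) C (n ∸ (k + t)))
    ≡⟨ cong₂ _*_ (C-absorption (κ + t) κ) (cong ((2 * n) C_) (sym ([m+n]∸[m+o]≡n∸o k m t))) ⟨
      k * multichoose k t * ((2 * n) C (m ∸ t))
    ≡⟨ x*y*z≡x*[z*y] k (multichoose k t) ((2 * n) C (m ∸ t)) ⟩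
      k * (((2 * n) C (m ∸ t)) * multichoose k t) ∎
    where
    x*y*z≡x*[z*y] : ∀ x y z → x * y * z ≡ x * (z * y)
    x*y*z≡x*[z*y] = ℕ-Solver.solve-∀

lhsSum-diagonal : ∀ κ → lhsSum (suc κ) (suc κ) ≡ + suc κ
lhsSum-diagonal κ = begin
    lhsSum (suc κ) (suc κ)                           ≡⟨ lhsSum≡coeff κ 0 (suc κ) (cong suc (sym (+-identityʳ κ))) ⟩
    + (suc κ * coeff (2 * suc κ) (suc κ) 0)          ≡⟨ cong (λ c → + (suc κ * c)) (coeff-zero (2 * suc κ) (suc κ)) ⟩
    + (suc κ * 1)                                    ≡⟨ cong +_ (*-identityʳ (suc κ)) ⟩
    + suc κ                                          ∎
  where open ≡-Reasoning

lhsSum-empty : ∀ {n k} → n < k → lhsSum n k ≡ + 0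
lhsSum-empty {n} {k} n<k rewrite sumFromTo-∑< k n (λ i → + (i * ((i ∸ 1) C (k ∸ 1)) * ((2 * n) C (n ∸ i))))
                                | m≤n⇒m∸n≡0 n<k = refl

private
  lift-recurrence : ∀ k N X A Y B Z → N * X ≡ A * Y + B * Z →
    + N ℤ.* + (k * X) ≡ + A ℤ.* + (k * Y) ℤ.+ + k ℤ.* + (B * Z)
  lift-recurrence k N X A Y B Z rec = begin
      + N ℤ.* + (k * X)                     ≡⟨ ℤP.pos-* N (k * X) ⟨
      + (N * (k * X))                       ≡⟨ cong +_ (trans (x∙yz≈y∙xz N k X) (cong (k *_) rec)) ⟩
      + (k * (A * Y + B * Z))               ≡⟨ cong +_ (rearrange k A Y B Z) ⟩
      + (A * (k * Y) + k * (B * Z))         ≡⟨ ℤP.pos-+ (A * (k * Y)) (k * (B * Z)) ⟩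
      + (A * (k * Y)) ℤ.+ + (k * (B * Z))   ≡⟨ cong₂ ℤ._+_ (ℤP.pos-* A (k * Y)) (ℤP.pos-* k (B * Z)) ⟩
      + A ℤ.* + (k * Y) ℤ.+ + k ℤ.* + (B * Z) ∎
    where
    open ≡-Reasoning
    rearrange : ∀ k A Y B Z → k * (A * Y + B * Z) ≡ A * (k * Y) + k * (B * Z)
    rearrange = ℕ-Solver.solve-∀

  lhsSum-recurrence-≤ : ∀ κ m n → n ≡ suc (suc κ) + m →
    + n ℤ.* lhsSum (suc n) (suc (suc κ)) ≡ + (2 * (2 * n + suc (suc κ))) ℤ.* lhsSum n (suc (suc κ)) ℤ.+ + suc (suc κ) ℤ.* lhsSum n (suc κ)
  lhsSum-recurrence-≤ κ m ._ refl = begin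
      + n ℤ.* lhsSum (suc n) k
    ≡⟨ cong (+ n ℤ.*_) (lhsSum≡coeff (suc κ) (suc m) (suc n) (sym (+-suc k m))) ⟩
      + n ℤ.* + (k * coeff (2 * suc n) k (suc m))
    ≡⟨ lift-recurrence k n (coeff (2 * suc n) k (suc m)) (2 * (2 * n + k)) (coeff (2 * n) k m) (suc κ) (coeff (2 * n) (suc κ) (suc m))
                           (coeff-recurrence (suc κ) m) ⟩
      + (2 * (2 * n + k)) ℤ.* + (k * coeff (2 * n) k m) ℤ.+ + k ℤ.* + (suc κ * coeff (2 * n) (suc κ) (suc m))
    ≡⟨ cong₂ (λ x y → + (2 * (2 * n + k)) ℤ.* x ℤ.+ + k ℤ.* y)
             (lhsSum≡coeff (suc κ) m n refl) (lhsSum≡coeff κ (suc m) n (sym (+-suc (suc κ) m))) ⟨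
      + (2 * (2 * n + k)) ℤ.* lhsSum n k ℤ.+ + k ℤ.* lhsSum n (suc κ) ∎
    where
    open ≡-Reasoning
    k = suc (suc κ)
    n = k + m

lhsSum-recurrence-one : ∀ n → + suc n ℤ.* lhsSum (suc (suc n)) 1 ≡ + (2 * (2 * suc n + 1)) ℤ.* lhsSum (suc n) 1
lhsSum-recurrence-one n = begin
    + suc n ℤ.* lhsSum (suc (suc n)) 1
  ≡⟨ cong (+ suc n ℤ.*_) (lhsSum≡coeff 0 (suc n) (suc (suc n)) refl) ⟩
    + suc n ℤ.* + (1 * coeff (2 * suc (suc n)) 1 (suc n))
  ≡⟨ lift-recurrence 1 (suc n) (coeff (2 * suc (suc n)) 1 (suc n)) (2 * (2 * suc n + 1)) (coeff (2 * suc n) 1 n)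
                      0 (coeff (2 * suc n) 0 (suc n)) (coeff-recurrence 0 n) ⟩
    + (2 * (2 * suc n + 1)) ℤ.* + (1 * coeff (2 * suc n) 1 n) ℤ.+ + 0
  ≡⟨ ℤP.+-identityʳ _ ⟩
    + (2 * (2 * suc n + 1)) ℤ.* + (1 * coeff (2 * suc n) 1 n)
  ≡⟨ cong (+ (2 * (2 * suc n + 1)) ℤ.*_) (lhsSum≡coeff 0 n (suc n) refl) ⟨
    + (2 * (2 * suc n + 1)) ℤ.* lhsSum (suc n) 1 ∎
  where open ≡-Reasoning

lhsSum-recurrence : ∀ n κ → let k = suc (suc κ) in
  + n ℤ.* lhsSum (suc n) k ≡ + (2 * (2 * n + k)) ℤ.* lhsSum n k ℤ.+ + k ℤ.* lhsSum n (suc κ)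
lhsSum-recurrence n κ with <-cmp (suc (suc κ)) (suc n)
... | tri< (s≤s k≤n) _ _ = lhsSum-recurrence-≤ κ (n ∸ suc (suc κ)) n (sym (m+[n∸m]≡n k≤n))
... | tri≈ _ refl _
  rewrite lhsSum-diagonal (suc κ) | lhsSum-diagonal κ | lhsSum-empty {suc κ} {suc (suc κ)} ≤-refl
  = diagonal (+ suc κ) (+ suc (suc κ)) (+ (2 * (2 * suc κ + suc (suc κ))))
  where
  diagonal : ∀ x y z → x ℤ.* y ≡ z ℤ.* + 0 ℤ.+ y ℤ.* x
  diagonal = ℤ-Solver.solve-∀
... | tri> _ _ 1+n<k
  rewrite lhsSum-empty 1+n<k | lhsSum-empty (m<n⇒m<1+n (s<s⁻¹ 1+n<k)) | lhsSum-empty (s<s⁻¹ 1+n<k)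
  = zeros (+ n) (+ (2 * (2 * n + suc (suc κ)))) (+ suc (suc κ))
  where
  zeros : ∀ x y z → x ℤ.* + 0 ≡ y ℤ.* + 0 ℤ.+ z ℤ.* + 0
  zeros = ℤ-Solver.solve-∀

rhsSum : ℕ → ℕ → ℤ
rhsSum n k = sumFromTo 1 k (λ i → signPow (k + i) ℤ.* + ((k C i) * prodStep2 i n))

private
  rhsTerm : ℕ → ℕ → ℕ → ℤ
  rhsTerm n k t = signPow (k + suc t) ℤ.* + ((k C suc t) * prodStep2 (suc t) n)

  rhsSum≡∑< : ∀ n k → rhsSum n k ≡ ℤ∑.∑< k (rhsTerm n k)
  rhsSum≡∑< n k = sumFromTo-∑< 1 k (λ i → signPow (k + i) ℤ.* + ((k C i) * prodStep2 i n))

  rhsTerm-last : ∀ n k → rhsTerm n k k ≡ + 0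
  rhsTerm-last n k = trans (cong (λ c → signPow (k + suc k) ℤ.* + (c * prodStep2 (suc k) n)) (k>n⇒nCk≡0 (n<1+n k)))
                           (ℤP.*-zeroʳ (signPow (k + suc k)))

  neg-split : ∀ σ {x y z} → x + y ≡ z → ℤ.- σ ℤ.* + x ≡ ℤ.- σ ℤ.* + z ℤ.+ σ ℤ.* + y
  neg-split σ {x} {y} x+y≡z = begin
      ℤ.- σ ℤ.* + x                                ≡⟨ add-and-subtract σ (+ x) (+ y) ⟩
      ℤ.- σ ℤ.* (+ x ℤ.+ + y) ℤ.+ σ ℤ.* + y        ≡⟨ cong (λ w → ℤ.- σ ℤ.* w ℤ.+ σ ℤ.* + y) (trans (sym (ℤP.pos-+ x y)) (cong +_ x+y≡z)) ⟩
      ℤ.- σ ℤ.* + _ ℤ.+ σ ℤ.* + y                  ∎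
    where
    open ≡-Reasoning
    add-and-subtract : ∀ σ a b → ℤ.- σ ℤ.* a ≡ ℤ.- σ ℤ.* (a ℤ.+ b) ℤ.+ σ ℤ.* b
    add-and-subtract = ℤ-Solver.solve-∀

  -- i C(k,i) = k C(k-1,i-1) turns the factor i + 2n of P(i, n+1) into 2n + k, up to k C(k-1,i)
  rhsTerm-weights : ∀ n κ t P → let B₁ = suc κ C suc t; B₀ = κ C suc t in
    B₁ * (P * (suc t + 2 * n)) + suc κ * (B₀ * P) ≡ (2 * n + suc κ) * (B₁ * P)
  rhsTerm-weights n κ t P = begin
      B₁ * (P * (suc t + 2 * n)) + suc κ * (B₀ * P)           ≡⟨ regroup (suc t) B₁ B₀ P n (suc κ) ⟩
      P * (suc t * B₁ + suc κ * B₀) + 2 * n * (B₁ * P)        ≡⟨ cong (λ w → P * w + 2 * n * (B₁ * P)) weights ⟩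
      P * (suc κ * B₁) + 2 * n * (B₁ * P)                     ≡⟨ collect B₁ P n (suc κ) ⟩
      (2 * n + suc κ) * (B₁ * P)                              ∎
    where
    open ≡-Reasoning
    B₁ = suc κ C suc t
    B₀ = κ C suc t
    weights : suc t * B₁ + suc κ * B₀ ≡ suc κ * B₁
    weights = trans (cong (_+ suc κ * B₀) (C-absorption κ t))
                    (trans (sym (*-distribˡ-+ (suc κ) (κ C t) B₀)) (cong (suc κ *_) (sym (C-pascal κ t))))
    regroup : ∀ i B₁ B₀ P n k → B₁ * (P * (i + 2 * n)) + k * (B₀ * P) ≡ P * (i * B₁ + k * B₀) + 2 * n * (B₁ * P)
    regroup = ℕ-Solver.solve-∀
    collect : ∀ B₁ P n k → P * (k * B₁) + 2 * n * (B₁ * P) ≡ (2 * n + k) * (B₁ * P)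
    collect = ℕ-Solver.solve-∀

  rhsTerm-recurrence : ∀ n κ t →
    rhsTerm (suc n) (suc κ) t ≡ + (2 * n + suc κ) ℤ.* rhsTerm n (suc κ) t ℤ.+ + suc κ ℤ.* rhsTerm n κ t
  rhsTerm-recurrence n κ t = begin
      ℤ.- σ ℤ.* + (B₁ * (P * (suc t + 2 * n)))
    ≡⟨ neg-split σ (rhsTerm-weights n κ t P) ⟩
      ℤ.- σ ℤ.* + ((2 * n + suc κ) * (B₁ * P)) ℤ.+ σ ℤ.* + (suc κ * (B₀ * P))
    ≡⟨ cong₂ (λ x y → ℤ.- σ ℤ.* x ℤ.+ σ ℤ.* y) (ℤP.pos-* (2 * n + suc κ) (B₁ * P)) (ℤP.pos-* (suc κ) (B₀ * P)) ⟩
      ℤ.- σ ℤ.* (+ (2 * n + suc κ) ℤ.* + (B₁ * P)) ℤ.+ σ ℤ.* (+ suc κ ℤ.* + (B₀ * P))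
    ≡⟨ regroup σ (+ (2 * n + suc κ)) (+ (B₁ * P)) (+ suc κ) (+ (B₀ * P)) ⟩
      + (2 * n + suc κ) ℤ.* (ℤ.- σ ℤ.* + (B₁ * P)) ℤ.+ + suc κ ℤ.* (σ ℤ.* + (B₀ * P)) ∎
    where
    open ≡-Reasoning
    σ = signPow (κ + suc t)
    B₁ = suc κ C suc t
    B₀ = κ C suc t
    P = prodStep2 (suc t) n
    regroup : ∀ σ c u k v → ℤ.- σ ℤ.* (c ℤ.* u) ℤ.+ σ ℤ.* (k ℤ.* v) ≡ c ℤ.* (ℤ.- σ ℤ.* u) ℤ.+ k ℤ.* (σ ℤ.* v)
    regroup = ℤ-Solver.solve-∀

rhsSum-recurrence : ∀ n κ → rhsSum (suc n) (suc κ) ≡ + (2 * n + suc κ) ℤ.* rhsSum n (suc κ) ℤ.+ + suc κ ℤ.* rhsSum n κ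
rhsSum-recurrence n κ = begin
    rhsSum (suc n) (suc κ)
  ≡⟨ rhsSum≡∑< (suc n) (suc κ) ⟩
    ℤ∑.∑< (suc κ) (rhsTerm (suc n) (suc κ))
  ≡⟨ ℤ∑.∑<-cong (suc κ) (λ t _ → rhsTerm-recurrence n κ t) ⟩
    ℤ∑.∑< (suc κ) (λ t → c ℤ.* rhsTerm n (suc κ) t ℤ.+ + suc κ ℤ.* rhsTerm n κ t)
  ≡⟨ ℤ∑.∑<-+ (suc κ) (λ t → c ℤ.* rhsTerm n (suc κ) t) (λ t → + suc κ ℤ.* rhsTerm n κ t) ⟩
    ℤ∑.∑< (suc κ) (λ t → c ℤ.* rhsTerm n (suc κ) t) ℤ.+ ℤ∑.∑< (suc κ) (λ t → + suc κ ℤ.* rhsTerm n κ t)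
  ≡⟨ cong₂ ℤ._+_ (ℤ∑.*-distribˡ-∑< (suc κ) c (rhsTerm n (suc κ))) (ℤ∑.*-distribˡ-∑< (suc κ) (+ suc κ) (rhsTerm n κ)) ⟨
    c ℤ.* ℤ∑.∑< (suc κ) (rhsTerm n (suc κ)) ℤ.+ + suc κ ℤ.* ℤ∑.∑< (suc κ) (rhsTerm n κ)
  ≡⟨ cong₂ (λ x y → c ℤ.* x ℤ.+ + suc κ ℤ.* y) (rhsSum≡∑< n (suc κ)) (trans (rhsSum≡∑< n κ) drop-last) ⟨
    c ℤ.* rhsSum n (suc κ) ℤ.+ + suc κ ℤ.* rhsSum n κ ∎
  where
  open ≡-Reasoning
  c = + (2 * n + suc κ)
  drop-last : ℤ∑.∑< κ (rhsTerm n κ) ≡ ℤ∑.∑< (suc κ) (rhsTerm n κ)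
  drop-last = sym (trans (cong (λ x → ℤ∑.∑< κ (rhsTerm n κ) ℤ.+ x) (rhsTerm-last n κ)) (ℤP.+-identityʳ _))

-- Pascal's rule makes the alternating sum telescope
rhsSum-zero : ∀ k → rhsSum 0 (suc k) ≡ signPow k
rhsSum-zero k = begin
    rhsSum 0 (suc k)
  ≡⟨ rhsSum≡∑< 0 (suc k) ⟩
    ℤ∑.∑< (suc k) (rhsTerm 0 (suc k))
  ≡⟨ ℤ∑.∑<-cong (suc k) (λ t _ → pascal-term t) ⟩
    ℤ∑.∑< (suc k) (λ t → u t ℤ.+ -1ℤ ℤ.* v t)
  ≡⟨ ℤ∑.∑<-+ (suc k) u (λ t → -1ℤ ℤ.* v t) ⟩
    ℤ∑.∑< (suc k) u ℤ.+ ℤ∑.∑< (suc k) (λ t → -1ℤ ℤ.* v t)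
  ≡⟨ cong₂ ℤ._+_ (ℤ∑.∑<-suc k u) (sym (ℤ∑.*-distribˡ-∑< (suc k) -1ℤ v)) ⟩
    u 0 ℤ.+ ℤ∑.∑< k v ℤ.+ -1ℤ ℤ.* (ℤ∑.∑< k v ℤ.+ v k)
  ≡⟨ cong (λ x → u 0 ℤ.+ ℤ∑.∑< k v ℤ.+ -1ℤ ℤ.* (ℤ∑.∑< k v ℤ.+ x)) (rhsTerm-last 0 k) ⟩
    u 0 ℤ.+ ℤ∑.∑< k v ℤ.+ -1ℤ ℤ.* (ℤ∑.∑< k v ℤ.+ + 0)
  ≡⟨ telescope (u 0) (ℤ∑.∑< k v) ⟩
    u 0
  ≡⟨ trans (ℤP.*-identityʳ (signPow (k + 0))) (cong signPow (+-identityʳ k)) ⟩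
    signPow k ∎
  where
  open ≡-Reasoning
  -1ℤ = ℤ.- + 1
  u v : ℕ → ℤ
  u t = signPow (k + t) ℤ.* + ((k C t) * 1)
  v = rhsTerm 0 k
  sign-shift : ∀ t → ℤ.- signPow (k + suc t) ≡ signPow (k + t)
  sign-shift t = trans (cong (λ j → ℤ.- signPow j) (+-suc k t)) (ℤP.neg-involutive (signPow (k + t)))
  pascal-term : ∀ t → rhsTerm 0 (suc k) t ≡ u t ℤ.+ -1ℤ ℤ.* v t
  pascal-term t = begin
      ℤ.- σ ℤ.* + ((suc k C suc t) * 1)
    ≡⟨ cong (λ c → ℤ.- σ ℤ.* + c) (trans (cong (_* 1) (C-pascal k t)) (*-distribʳ-+ 1 (k C t) (k C suc t))) ⟩
      ℤ.- σ ℤ.* + ((k C t) * 1 + (k C suc t) * 1)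
    ≡⟨ cong (ℤ.- σ ℤ.*_) (ℤP.pos-+ ((k C t) * 1) ((k C suc t) * 1)) ⟩
      ℤ.- σ ℤ.* (+ ((k C t) * 1) ℤ.+ + ((k C suc t) * 1))
    ≡⟨ split σ (+ ((k C t) * 1)) (+ ((k C suc t) * 1)) ⟩
      ℤ.- σ ℤ.* + ((k C t) * 1) ℤ.+ -1ℤ ℤ.* v t
    ≡⟨ cong (λ s → s ℤ.* + ((k C t) * 1) ℤ.+ -1ℤ ℤ.* v t) (sign-shift t) ⟩
      u t ℤ.+ -1ℤ ℤ.* v t ∎
    where
    σ = signPow (k + suc t)
    split : ∀ σ x y → ℤ.- σ ℤ.* (x ℤ.+ y) ≡ ℤ.- σ ℤ.* x ℤ.+ ℤ.- + 1 ℤ.* (σ ℤ.* y)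
    split = ℤ-Solver.solve-∀
  telescope : ∀ x s → x ℤ.+ s ℤ.+ ℤ.- + 1 ℤ.* (s ℤ.+ + 0) ≡ x
  telescope = ℤ-Solver.solve-∀

rhsSum-one : ∀ κ → rhsSum 1 (suc (suc κ)) ≡ + 0
rhsSum-one κ = begin
    rhsSum 1 (suc (suc κ))
  ≡⟨ rhsSum-recurrence 0 (suc κ) ⟩
    + suc (suc κ) ℤ.* rhsSum 0 (suc (suc κ)) ℤ.+ + suc (suc κ) ℤ.* rhsSum 0 (suc κ)
  ≡⟨ cong₂ (λ x y → + suc (suc κ) ℤ.* x ℤ.+ + suc (suc κ) ℤ.* y) (rhsSum-zero (suc κ)) (rhsSum-zero κ) ⟩
    + suc (suc κ) ℤ.* ℤ.- signPow κ ℤ.+ + suc (suc κ) ℤ.* signPow κ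
  ≡⟨ cancel (+ suc (suc κ)) (signPow κ) ⟩
    + 0 ∎
  where
  open ≡-Reasoning
  cancel : ∀ c s → c ℤ.* ℤ.- s ℤ.+ c ℤ.* s ≡ + 0
  cancel = ℤ-Solver.solve-∀

private
  scaling-step : ∀ (T N F P c k a a₀ a₁ b₀ b₁ : ℤ) →
    N ℤ.* a ≡ (+ 2 ℤ.* c) ℤ.* a₀ ℤ.+ k ℤ.* a₁ →
    (+ 2 ℤ.* T) ℤ.* F ℤ.* a₀ ≡ P ℤ.* b₀ →
    T ℤ.* F ℤ.* a₁ ≡ P ℤ.* b₁ →
    (+ 2 ℤ.* T) ℤ.* (N ℤ.* F) ℤ.* a ≡ (+ 2 ℤ.* P) ℤ.* (c ℤ.* b₀ ℤ.+ k ℤ.* b₁)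
  scaling-step T N F P c k a a₀ a₁ b₀ b₁ recurrence hyp₀ hyp₁ = begin
      (+ 2 ℤ.* T) ℤ.* (N ℤ.* F) ℤ.* a
    ≡⟨ pull-out T N F a ⟩
      (+ 2 ℤ.* T) ℤ.* F ℤ.* (N ℤ.* a)
    ≡⟨ cong ((+ 2 ℤ.* T) ℤ.* F ℤ.*_) recurrence ⟩
      (+ 2 ℤ.* T) ℤ.* F ℤ.* ((+ 2 ℤ.* c) ℤ.* a₀ ℤ.+ k ℤ.* a₁)
    ≡⟨ distribute T F c k a₀ a₁ ⟩
      (+ 2 ℤ.* c) ℤ.* ((+ 2 ℤ.* T) ℤ.* F ℤ.* a₀) ℤ.+ (+ 2 ℤ.* k) ℤ.* (T ℤ.* F ℤ.* a₁)
    ≡⟨ cong₂ (λ x y → (+ 2 ℤ.* c) ℤ.* x ℤ.+ (+ 2 ℤ.* k) ℤ.* y) hyp₀ hyp₁ ⟩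
      (+ 2 ℤ.* c) ℤ.* (P ℤ.* b₀) ℤ.+ (+ 2 ℤ.* k) ℤ.* (P ℤ.* b₁)
    ≡⟨ collect P c k b₀ b₁ ⟩
      (+ 2 ℤ.* P) ℤ.* (c ℤ.* b₀ ℤ.+ k ℤ.* b₁) ∎
    where
    open ≡-Reasoning
    pull-out : ∀ T N F a → (+ 2 ℤ.* T) ℤ.* (N ℤ.* F) ℤ.* a ≡ (+ 2 ℤ.* T) ℤ.* F ℤ.* (N ℤ.* a)
    pull-out = ℤ-Solver.solve-∀
    distribute : ∀ T F c k a₀ a₁ → (+ 2 ℤ.* T) ℤ.* F ℤ.* ((+ 2 ℤ.* c) ℤ.* a₀ ℤ.+ k ℤ.* a₁)
                 ≡ (+ 2 ℤ.* c) ℤ.* ((+ 2 ℤ.* T) ℤ.* F ℤ.* a₀) ℤ.+ (+ 2 ℤ.* k) ℤ.* (T ℤ.* F ℤ.* a₁)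
    distribute = ℤ-Solver.solve-∀
    collect : ∀ P c k b₀ b₁ → (+ 2 ℤ.* c) ℤ.* (P ℤ.* b₀) ℤ.+ (+ 2 ℤ.* k) ℤ.* (P ℤ.* b₁) ≡ (+ 2 ℤ.* P) ℤ.* (c ℤ.* b₀ ℤ.+ k ℤ.* b₁)
    collect = ℤ-Solver.solve-∀

  pos-2^* : ∀ κ m → + (2 ^ suc κ * m) ≡ + 2 ℤ.* + (2 ^ κ) ℤ.* + m
  pos-2^* κ m = trans (ℤP.pos-* (2 ^ suc κ) m) (cong (ℤ._* + m) (ℤP.pos-* 2 (2 ^ κ)))

  scaled-recurrence : ∀ n κ {a a₀ a₁ b₀ b₁ : ℤ} →
    + suc n ℤ.* a ≡ + (2 * (2 * suc n + suc κ)) ℤ.* a₀ ℤ.+ + suc κ ℤ.* a₁ →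
    + (2 ^ suc κ * n !) ℤ.* a₀ ≡ + (2 ^ suc n) ℤ.* b₀ →
    + (2 ^ κ * n !) ℤ.* a₁ ≡ + (2 ^ suc n) ℤ.* b₁ →
    + (2 ^ suc κ * suc n !) ℤ.* a ≡ + (2 ^ suc (suc n)) ℤ.* (+ (2 * suc n + suc κ) ℤ.* b₀ ℤ.+ + suc κ ℤ.* b₁)
  scaled-recurrence n κ {a} {a₀} {a₁} {b₀} {b₁} recurrence hyp₀ hyp₁ = begin
      + (2 ^ suc κ * suc n !) ℤ.* a
    ≡⟨ cong (ℤ._* a) (trans (pos-2^* κ (suc n !)) (cong (+ 2 ℤ.* + (2 ^ κ) ℤ.*_) (ℤP.pos-* (suc n) (n !)))) ⟩
      (+ 2 ℤ.* + (2 ^ κ)) ℤ.* (+ suc n ℤ.* + (n !)) ℤ.* a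
    ≡⟨ scaling-step (+ (2 ^ κ)) (+ suc n) (+ (n !)) (+ (2 ^ suc n)) (+ (2 * suc n + suc κ)) (+ suc κ) a a₀ a₁ b₀ b₁
         (trans recurrence (cong (λ x → x ℤ.* a₀ ℤ.+ + suc κ ℤ.* a₁) (ℤP.pos-* 2 (2 * suc n + suc κ))))
         (trans (cong (ℤ._* a₀) (sym (pos-2^* κ (n !)))) hyp₀)
         (trans (cong (ℤ._* a₁) (sym (ℤP.pos-* (2 ^ κ) (n !)))) hyp₁) ⟩
      (+ 2 ℤ.* + (2 ^ suc n)) ℤ.* (+ (2 * suc n + suc κ) ℤ.* b₀ ℤ.+ + suc κ ℤ.* b₁)
    ≡⟨ cong (ℤ._* (+ (2 * suc n + suc κ) ℤ.* b₀ ℤ.+ + suc κ ℤ.* b₁)) (ℤP.pos-* 2 (2 ^ suc n)) ⟨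
      + (2 ^ suc (suc n)) ℤ.* (+ (2 * suc n + suc κ) ℤ.* b₀ ℤ.+ + suc κ ℤ.* b₁) ∎
    where open ≡-Reasoning

scaled-identity : ∀ n k → 1 ≤ k → + (2 ^ k * n !) ℤ.* lhsSum (suc n) k ≡ + (2 ^ suc n) ℤ.* rhsSum (suc n) k
scaled-identity zero    (suc zero)    _ = refl
scaled-identity zero    (suc (suc κ)) _ = begin
    + (2 ^ suc (suc κ) * 1) ℤ.* lhsSum 1 (suc (suc κ))   ≡⟨ cong (+ (2 ^ suc (suc κ) * 1) ℤ.*_) (lhsSum-empty {1} {suc (suc κ)} (s≤s (s≤s z≤n))) ⟩
    + (2 ^ suc (suc κ) * 1) ℤ.* + 0                      ≡⟨ ℤP.*-zeroʳ (+ (2 ^ suc (suc κ) * 1)) ⟩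
    + 0                                                  ≡⟨ ℤP.*-zeroʳ (+ 2) ⟨
    + 2 ℤ.* + 0                                          ≡⟨ cong (+ 2 ℤ.*_) (rhsSum-one κ) ⟨
    + 2 ℤ.* rhsSum 1 (suc (suc κ))                       ∎
  where open ≡-Reasoning
scaled-identity (suc n) (suc zero)    _ =
  trans (scaled-recurrence n 0 (trans (lhsSum-recurrence-one n) (sym (ℤP.+-identityʳ _)))
                               (scaled-identity n 1 (s≤s z≤n))
                               (trans (ℤP.*-zeroʳ (+ (1 * n !))) (sym (ℤP.*-zeroʳ (+ (2 ^ suc n))))))
        (cong (+ (2 ^ suc (suc n)) ℤ.*_) (sym (rhsSum-recurrence (suc n) 0)))
scaled-identity (suc n) (suc (suc κ)) _ =
  trans (scaled-recurrence n (suc κ) (lhsSum-recurrence (suc n) κ)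
                                     (scaled-identity n (suc (suc κ)) (s≤s z≤n))
                                     (scaled-identity n (suc κ) (s≤s z≤n)))
        (cong (+ (2 ^ suc (suc n)) ℤ.*_) (sym (rhsSum-recurrence (suc n) (suc κ))))

cancel-2^ : ∀ {k n} → k ≤ n → ∀ d a b → + (2 ^ k * d) ℤ.* a ≡ + (2 ^ n) ℤ.* b → + d ℤ.* a ≡ + (2 ^ (n ∸ k)) ℤ.* b
cancel-2^ {k} {n} k≤n d a b eq = ℤP.*-cancelˡ-≡ (+ (2 ^ k)) _ _ {{m^n≢0 2 k}} (begin
    + (2 ^ k) ℤ.* (+ d ℤ.* a)             ≡⟨ ℤP.*-assoc (+ (2 ^ k)) (+ d) a ⟨
    + (2 ^ k) ℤ.* + d ℤ.* a               ≡⟨ cong (ℤ._* a) (ℤP.pos-* (2 ^ k) d) ⟨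
    + (2 ^ k * d) ℤ.* a                   ≡⟨ eq ⟩
    + (2 ^ n) ℤ.* b                       ≡⟨ cong (λ e → + (2 ^ e) ℤ.* b) (m+[n∸m]≡n k≤n) ⟨
    + (2 ^ (k + (n ∸ k))) ℤ.* b           ≡⟨ cong (λ e → + e ℤ.* b) (^-distribˡ-+-* 2 k (n ∸ k)) ⟩
    + (2 ^ k * 2 ^ (n ∸ k)) ℤ.* b         ≡⟨ cong (ℤ._* b) (ℤP.pos-* (2 ^ k) (2 ^ (n ∸ k))) ⟩
    + (2 ^ k) ℤ.* + (2 ^ (n ∸ k)) ℤ.* b   ≡⟨ ℤP.*-assoc (+ (2 ^ k)) (+ (2 ^ (n ∸ k))) b ⟩
    + (2 ^ k) ℤ.* (+ (2 ^ (n ∸ k)) ℤ.* b) ∎)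
  where open ≡-Reasoning

d*a≡q*b⇒a≡q/d*b : ∀ (a q b : ℤ) d .{{_ : NonZero d}} → + d ℤ.* a ≡ q ℤ.* b → a / 1 ≡ (q / d) ℚ.* (b / 1)
d*a≡q*b⇒a≡q/d*b a q b (suc d) eq = ℚP.toℚᵘ-injective
  (ℚᵘP.≃-trans (ℚP.toℚᵘ-fromℚᵘ (ℚᵘ.mkℚᵘ a 0))
   (ℚᵘP.≃-trans (ℚᵘ.*≡* cross-multiplied)
    (ℚᵘP.≃-sym (ℚᵘP.≃-trans (ℚP.toℚᵘ-homo-* (q / suc d) (b / 1))
       (ℚᵘP.*-cong (ℚP.toℚᵘ-fromℚᵘ (ℚᵘ.mkℚᵘ q d)) (ℚP.toℚᵘ-fromℚᵘ (ℚᵘ.mkℚᵘ b 0)))))))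
  where
  cross-multiplied : a ℤ.* + (suc d * 1) ≡ (q ℤ.* b) ℤ.* + 1
  cross-multiplied = trans (trans (cong (λ x → a ℤ.* + x) (*-identityʳ (suc d))) (ℤP.*-comm a (+ suc d)))
                           (trans eq (sym (ℤP.*-identityʳ (q ℤ.* b))))

mainTheorem20 : (k n : ℕ) → 1 ≤ k → k ≤ n →
    (sumFromTo k n (λ i → + (i * ((i ∸ 1) C (k ∸ 1)) * ((2 * n) C (n ∸ i)))) / 1)
      ≡ ((+ (2 ^ (n ∸ k)) / ((n ∸ 1) !)) {{(n ∸ 1) !≢0}} ℚ.* (sumFromTo 1 k (λ i → signPow (k + i) ℤ.* + ((k C i) * prodStep2 i n)) / 1))
mainTheorem20 _ zero    (s≤s _) ()
mainTheorem20 k (suc n) 1≤k     k≤n =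
  d*a≡q*b⇒a≡q/d*b (lhsSum (suc n) k) (+ (2 ^ (suc n ∸ k))) (rhsSum (suc n) k) (n !) {{n !≢0}}
    (cancel-2^ k≤n (n !) (lhsSum (suc n) k) (rhsSum (suc n) k) (scaled-identity n k 1≤k))
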